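{- Every conserved interval $I$ of $\mathcal{P}$ admits a unique inclusion-maximal set of frontiers, denoted $F_I$. Moreover, every conserved interval $I$ of $\mathcal{P}$ with $|I|\ge 2$ satisfies one of the following: 1. $I$ is strong; 2. $I$ is weak, and there exist a unique strong conserved interval $J$ of $\mathcal{P}$ and two frontiers $f_i,f_j\in F_J$ with $f_i<f_j$ such that $I=(f_i..f_j)$; moreover $F_I=F_J\cap I$ and $J=\mathrm{Container}(I)$.
   Context: Let $n\ge 2$, $K\ge1$, and let $\mathcal{P}=\{P_1,\ldots,P_K\}$ be a set of signed permutations of $\{1,\ldots,n\}$: each $P_k$ is a sequence in which each of $1,\ldots,n$ appears exactly once, with a sign $+$ or $-$. Assume each $P_k$ begins with $+1$ and ends with $+n$, and $P_1=\mathrm{Id}_n$ (identity order, all signs $+$). For $i\le j$, $(i..j)=\{i,\ldots,j\}$. A conserved interval of $\mathcal{P}$ is either a singleton, or a set $(a..c)$ with $a<c$ such that in every $P_k$ the elements of $(a..c)$ (ignoring signs) occupy consecutive positions and this block is delimited either by $+a$ on the left and $+c$ on the right, or by $-c$ on the left and $-a$ on the right. Intervals $(i..j)$ and $(k..l)$ overlap if $i<k\le j<l$ or $k<i\le l<j$. A conserved interval is strong if it has at least two elements and overlaps no conserved interval; otherwise it is weak. For a conserved interval $I=(a..c)$, a set $\{f_1,\ldots,f_k\}$ with $a=f_1<\cdots<f_k=c$ is a set of frontiers of $I$ if $(f_i..f_j)$ is conserved for all $1\le i<j\le k$. For a conserved interval $I$, $\mathrm{Container}(I)$ is the smallest strong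 conserved interval containing $I$ (note $(1..n)$ is strong). -}

module Defs where

open import Data.Nat using (ℕ; zero; suc; _≤_; _<_)
open import Data.Fin using (Fin; toℕ)
open import Data.Integer using (ℤ; +_; -_; ∣_∣)
open import Data.Product using (Σ; ∃; _×_; _,_)
open import Data.Sum using (_⊎_)
open import Data.List using (List)
open import Data.List.Membership.Propositional using (_∈_)
open import Data.List.Relation.Unary.All using (All)
open import Data.List.Relation.Unary.Linked using (Linked)
open import Data.List.Relation.Binary.Subset.Propositional using (_⊆_)
open import Relation.Binary.PropositionalEquality using (_≡_)
open import Relation.Nullary using (¬_)

SignedSeq : ℕ → Set
SignedSeq n = Fin n → ℤ

-- Each of 1..n appears exactly once (ignoring signs): absolute values lie in
-- 1..n and are pairwise distinct (hence a bijection onto 1..n).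
IsSignedPerm : (n : ℕ) → SignedSeq n → Set
IsSignedPerm n P =
  (∀ i → (1 ≤ ∣ P i ∣) × (∣ P i ∣ ≤ n)) ×
  (∀ i j → ∣ P i ∣ ≡ ∣ P j ∣ → i ≡ j)

FramedPerm : (n : ℕ) → SignedSeq n → Set
FramedPerm n P =
  (∀ i → toℕ i ≡ 0 → P i ≡ + 1) ×
  (∀ i → suc (toℕ i) ≡ n → P i ≡ + n)

IsIdentity : (n : ℕ) → SignedSeq n → Set
IsIdentity n P = ∀ i → P i ≡ + suc (toℕ i)

InRange : ℕ → ℕ → ℕ → Set
InRange a c x = (a ≤ x) × (x ≤ c)

Block : {n : ℕ} → SignedSeq n → ℕ → ℕ → Set
Block {n} P a c =
  Σ (Fin n) λ p → Σ (Fin n) λ q →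
    (∀ r → (InRange (toℕ p) (toℕ q) (toℕ r) → InRange a c ∣ P r ∣) ×
           (InRange a c ∣ P r ∣ → InRange (toℕ p) (toℕ q) (toℕ r))) ×
    (((P p ≡ + a) × (P q ≡ + c)) ⊎ ((P p ≡ - (+ c)) × (P q ≡ - (+ a))))

module _ {n K : ℕ} (𝒫 : Fin K → SignedSeq n) where

  Conserved : ℕ → ℕ → Set
  Conserved a c =
    ((a ≡ c) × (1 ≤ a) × (a ≤ n)) ⊎
    ((a < c) × (∀ k → Block (𝒫 k) a c))

  Overlap : ℕ → ℕ → ℕ → ℕ → Set
  Overlap i j k l =
    ((i < k) × (k ≤ j) × (j < l)) ⊎ ((k < i) × (i ≤ l) × (l < j))

  Strong : ℕ → ℕ → Set
  Strong a c =
    Conserved a c × (a < c) ×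
    (∀ k l → Conserved k l → ¬ Overlap a c k l)

  Weak : ℕ → ℕ → Set
  Weak a c = Conserved a c × ¬ Strong a c

  -- F (a strictly increasing list, i.e. a finite set listed in order
  -- f₁ < … < f_k) is a set of frontiers of (a..c)
  IsFrontierSet : ℕ → ℕ → List ℕ → Set
  IsFrontierSet a c F =
    Linked _<_ F × (a ∈ F) × (c ∈ F) × All (InRange a c) F ×
    (∀ x y → x ∈ F → y ∈ F → x < y → Conserved x y)

  IsMaxFrontierSet : ℕ → ℕ → List ℕ → Set
  IsMaxFrontierSet a c F =
    IsFrontierSet a c F × (∀ G → IsFrontierSet a c G → F ⊆ G → G ⊆ F)

  IsContainer : ℕ → ℕ → ℕ → ℕ → Set
  IsContainer a c e f =
    Strong e f × (e ≤ a) × (c ≤ f) ×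
    (∀ g h → Strong g h → g ≤ a → c ≤ h → (g ≤ e) × (f ≤ h))

-- In every permutation a conserved interval is a block of consecutive positions, and
-- comparing blocks gives the closure properties of conserved intervals: overlapping ones
-- have a conserved union, and if (a..b) and (a..c) are conserved with b ≤ c then so is
-- (b..c) (and symmetrically on the right). Hence the frontiers of (a..c) are exactly the
-- x with (a..x) and (x..c) conserved; listed in order they form the unique maximal set of
-- frontiers. For a < c, let e be least with (e..a) conserved and f greatest with (c..f)
-- conserved. An interval overlapping (e..f) would push e further left or f further right,
-- so (e..f) is strong; it is the only strong interval having a and c as frontiers, the
-- smallest strong interval containing (a..c), and it equals (a..c) iff (a..c) is strong.

module Submission where

open import Defs
open import Data.Nat using (ℕ; suc; s≤s; _≤_; _<_; _∸_; _≤?_; _<?_; _≟_)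
open import Data.Nat.Properties
open import Data.Nat.Induction using (<-rec)
open import Data.Fin using (Fin; toℕ; fromℕ<)
open import Data.Fin.Properties using (toℕ-injective; any?; all?)
open import Data.Integer using (+_; -_; ∣_∣)
import Data.Integer.Properties as ℤ
open import Data.Product using (Σ; ∃; _×_; _,_; proj₁; proj₂)
open import Data.Sum using (_⊎_; inj₁; inj₂; swap; [_,_]′)
open import Data.Empty using (⊥; ⊥-elim)
open import Data.List using (List; []; _∷_; filter; upTo)
open import Data.List.Membership.Propositional using (_∈_)
open import Data.List.Membership.Propositional.Properties using (∈-filter⁺; ∈-filter⁻; ∈-upTo⁺)
open import Data.List.Relation.Unary.Any using (here; there)
import Data.List.Relation.Unary.All as All
open import Data.List.Relation.Unary.Linked using (Linked; _∷_; tail)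
import Data.List.Relation.Unary.Linked.Properties as Linkedₚ
open import Data.List.Relation.Binary.Subset.Propositional using (_⊆_)
open import Function using (_∘_; id; case_of_)
open import Level using (0ℓ)
open import Relation.Binary.PropositionalEquality using (_≡_; refl; sym; trans; cong; subst; subst₂)
open import Relation.Binary.Definitions using (tri<; tri≈; tri>)
open import Relation.Nullary using (¬_; Dec; yes; no)
open import Relation.Nullary.Decidable using (_×-dec_; _⊎-dec_; _→-dec_; toSum)
open import Relation.Unary using (Pred; Decidable; _≐_; _∪_)
  renaming (_⊆_ to _⊆ₚ_)
open import Relation.Unary.Properties using (≐-sym; ≐-trans)

least-witness : {Q : Pred ℕ 0ℓ} → Decidable Q → ∀ {x} → Q x →
        ∃ λ e → Q e × e ≤ x × (∀ {y} → y < e → ¬ Q y)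
least-witness {Q} Q? {x} = <-rec _ step x
  where
  step : ∀ x → (∀ {y} → y < x → Q y → ∃ λ e → Q e × e ≤ y × (∀ {z} → z < e → ¬ Q z)) →
         Q x → ∃ λ e → Q e × e ≤ x × (∀ {y} → y < e → ¬ Q y)
  step x below qx with anyUpTo? Q? x
  ... | yes (y , y<x , qy) = let e , qe , e≤y , minimal = below y<x qy
                             in e , qe , ≤-trans e≤y (<⇒≤ y<x) , minimal
  ... | no none = x , qx , ≤-refl , λ y<x qy → none (_ , y<x , qy)

-- The greatest witness below N is the least witness of Q (N ∸ _).
greatest-witness : {Q : Pred ℕ 0ℓ} → Decidable Q → ∀ {N} → (∀ {y} → Q y → y ≤ N) → ∀ {x} → Q x →
           ∃ λ f → Q f × (∀ {y} → f < y → ¬ Q y)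
greatest-witness {Q} Q? {N} bounded {x} qx = case least-witness (λ y → Q? (N ∸ y)) (reflect qx) of λ
  { (z , qz , z≤N∸x , minimal) → N ∸ z , qz , λ {y} N∸z<y qy →
      minimal (subst (N ∸ y <_) (m∸[m∸n]≡n (≤-trans z≤N∸x (m∸n≤m N x))) (∸-monoʳ-< N∸z<y (bounded qy)))
              (reflect qy) }
  where
  reflect : ∀ {y} → Q y → Q (N ∸ (N ∸ y))
  reflect qy = subst Q (sym (m∸[m∸n]≡n (bounded qy))) qy

head-< : ∀ {x y ys} → Linked _<_ (x ∷ ys) → y ∈ ys → x < y
head-< (x<z ∷ _) (here refl) = x<z
head-< (x<z ∷ sorted) (there y∈ys) = <-trans x<z (head-< sorted y∈ys)

sorted-⊆-antisym : ∀ {xs ys} → Linked _<_ xs → Linked _<_ ys → xs ⊆ ys → ys ⊆ xs → xs ≡ ys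
sorted-⊆-antisym {[]} {[]} _ _ _ _ = refl
sorted-⊆-antisym {[]} {y ∷ ys} _ _ _ ys⊆xs with ys⊆xs (here refl)
... | ()
sorted-⊆-antisym {x ∷ xs} {[]} _ _ xs⊆ys _ with xs⊆ys (here refl)
... | ()
sorted-⊆-antisym {x ∷ xs} {y ∷ ys} sx sy xs⊆ys ys⊆xs with xs⊆ys (here refl) | ys⊆xs (here refl)
... | here refl | _ = cong (x ∷_) (sorted-⊆-antisym (tail sx) (tail sy) (drop sx xs⊆ys) (drop sy ys⊆xs))
  where
  drop : ∀ {zs ws} → Linked _<_ (x ∷ zs) → x ∷ zs ⊆ x ∷ ws → zs ⊆ ws
  drop s sub z∈zs with sub (there z∈zs)
  ... | here refl = ⊥-elim (<-irrefl refl (head-< s z∈zs))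
  ... | there z∈ws = z∈ws
... | there x∈ys | here refl = ⊥-elim (<-irrefl refl (head-< sy x∈ys))
... | there x∈ys | there y∈xs = ⊥-elim (<-asym (head-< sy x∈ys) (head-< sx y∈xs))

range-∪ : ∀ {i j k l} → i ≤ k → k ≤ j → j ≤ l → InRange i j ∪ InRange k l ≐ InRange i l
range-∪ {i} {j} {k} {l} i≤k k≤j j≤l = join , split
  where
  join : InRange i j ∪ InRange k l ⊆ₚ InRange i l
  join (inj₁ (i≤x , x≤j)) = i≤x , ≤-trans x≤j j≤l
  join (inj₂ (k≤x , x≤l)) = ≤-trans i≤k k≤x , x≤l
  split : InRange i l ⊆ₚ InRange i j ∪ InRange k l
  split {x} (i≤x , x≤l) with x ≤? j
  ... | yes x≤j = inj₁ (i≤x , x≤j)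
  ... | no x≰j = inj₂ (≤-trans k≤j (<⇒≤ (≰⇒> x≰j)) , x≤l)

module Occupancy {n : ℕ} (P : SignedSeq n) where

  value : Fin n → ℕ
  value r = ∣ P r ∣

  Between : Fin n → Fin n → Fin n → Set
  Between p q r = InRange (toℕ p) (toℕ q) (toℕ r)

  -- Block P a c consists of positions p, q with Occupies (InRange a c) p q and delimiting signs.
  Occupies : Pred ℕ 0ℓ → Fin n → Fin n → Set
  Occupies V p q = ∀ r → (Between p q r → V (value r)) × (V (value r) → Between p q r)

  occupies-≐ : ∀ {A B p q} → A ≐ B → Occupies A p q → Occupies B p q
  occupies-≐ (A⊆B , B⊆A) occ r = (λ b → A⊆B (proj₁ (occ r) b)) , (λ v → proj₂ (occ r) (B⊆A v))

  occupies-∪ : ∀ {A B p₁ q₁ p₂ q₂} →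
               toℕ p₁ ≤ toℕ p₂ → toℕ p₂ ≤ toℕ q₁ → toℕ q₁ ≤ toℕ q₂ →
               Occupies A p₁ q₁ → Occupies B p₂ q₂ → Occupies (A ∪ B) p₁ q₂
  occupies-∪ {A} {B} {p₁} {q₁} {p₂} {q₂} p₁≤p₂ p₂≤q₁ q₁≤q₂ occ₁ occ₂ r = inside , located
    where
    inside : Between p₁ q₂ r → (A ∪ B) (value r)
    inside (p₁≤r , r≤q₂) with toℕ r ≤? toℕ q₁
    ... | yes r≤q₁ = inj₁ (proj₁ (occ₁ r) (p₁≤r , r≤q₁))
    ... | no r≰q₁ = inj₂ (proj₁ (occ₂ r) (≤-trans p₂≤q₁ (<⇒≤ (≰⇒> r≰q₁)) , r≤q₂))
    located : (A ∪ B) (value r) → Between p₁ q₂ r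
    located (inj₁ a) = let p₁≤r , r≤q₁ = proj₂ (occ₁ r) a in p₁≤r , ≤-trans r≤q₁ q₁≤q₂
    located (inj₂ b) = let p₂≤r , r≤q₂ = proj₂ (occ₂ r) b in ≤-trans p₁≤p₂ p₂≤r , r≤q₂

  left-of : ∀ {A p q r} → Occupies A p q → ¬ A (value r) → toℕ r ≤ toℕ q → toℕ r < toℕ p
  left-of {p = p} {r = r} occ ¬a r≤q with toℕ p ≤? toℕ r
  ... | yes p≤r = ⊥-elim (¬a (proj₁ (occ r) (p≤r , r≤q)))
  ... | no p≰r = ≰⇒> p≰r

  right-of : ∀ {A p q r} → Occupies A p q → ¬ A (value r) → toℕ p ≤ toℕ r → toℕ q < toℕ r
  right-of {q = q} {r} occ ¬a p≤r with toℕ r ≤? toℕ q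
  ... | yes r≤q = ⊥-elim (¬a (proj₁ (occ r) (p≤r , r≤q)))
  ... | no r≰q = ≰⇒> r≰q

  record Splits (B A D : Pred ℕ 0ℓ) (s : Fin n) : Set where
    field
      cover : B ≐ A ∪ D
      meet  : ∀ {r} → A (value r) → D (value r) → r ≡ s
      atˡ   : A (value s)
      atʳ   : D (value s)

  splits-swap : ∀ {B A D s} → Splits B A D s → Splits B D A s
  splits-swap σ = record
    { cover = (λ b → swap (proj₁ cover b)) , (λ d∪a → proj₂ cover (swap d∪a))
    ; meet  = λ d a → meet a d
    ; atˡ   = atʳ
    ; atʳ   = atˡ
    }
    where open Splits σ

  occupies-splitˡ : ∀ {B A D s p q} → Splits B A D s → Occupies A p s → Occupies B p q → Occupies D s q
  occupies-splitˡ {D = D} {s} {p} {q} σ occA occB r = inside , located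
    where
    open Splits σ
    p≤s : toℕ p ≤ toℕ s
    p≤s = proj₁ (proj₂ (occA s) atˡ)
    inside : Between s q r → D (value r)
    inside (s≤r , r≤q) with proj₁ cover (proj₁ (occB r) (≤-trans p≤s s≤r , r≤q))
    ... | inj₂ d = d
    ... | inj₁ a with toℕ-injective (≤-antisym (proj₂ (proj₂ (occA r) a)) s≤r)
    ...   | refl = atʳ
    located : D (value r) → Between s q r
    located d with toℕ s ≤? toℕ r
    ... | yes s≤r = s≤r , proj₂ (proj₂ (occB r) (proj₂ cover (inj₂ d)))
    ... | no s≰r = ⊥-elim (<-irrefl (cong toℕ r≡s) (≰⇒> s≰r))
      where
      p≤r : toℕ p ≤ toℕ r
      p≤r = proj₁ (proj₂ (occB r) (proj₂ cover (inj₂ d)))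
      r≡s : r ≡ s
      r≡s = meet (proj₁ (occA r) (p≤r , <⇒≤ (≰⇒> s≰r))) d

  occupies-splitʳ : ∀ {B A D s p q} → Splits B A D s → Occupies A s q → Occupies B p q → Occupies D p s
  occupies-splitʳ {D = D} {s} {p} {q} σ occA occB r = inside , located
    where
    open Splits σ
    s≤q : toℕ s ≤ toℕ q
    s≤q = proj₂ (proj₂ (occA s) atˡ)
    inside : Between p s r → D (value r)
    inside (p≤r , r≤s) with proj₁ cover (proj₁ (occB r) (p≤r , ≤-trans r≤s s≤q))
    ... | inj₂ d = d
    ... | inj₁ a with toℕ-injective (≤-antisym r≤s (proj₁ (proj₂ (occA r) a)))
    ...   | refl = atʳ
    located : D (value r) → Between p s r
    located d with toℕ r ≤? toℕ s
    ... | yes r≤s = proj₁ (proj₂ (occB r) (proj₂ cover (inj₂ d))) , r≤s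
    ... | no r≰s = ⊥-elim (<-irrefl (cong toℕ (sym r≡s)) (≰⇒> r≰s))
      where
      r≤q : toℕ r ≤ toℕ q
      r≤q = proj₂ (proj₂ (occB r) (proj₂ cover (inj₂ d)))
      r≡s : r ≡ s
      r≡s = meet (proj₁ (occA r) (<⇒≤ (≰⇒> r≰s) , r≤q)) d

module SignedPermutation {n : ℕ} (P : SignedSeq n) (perm : IsSignedPerm n P) where
  open Occupancy P

  value-bounds : ∀ r → 1 ≤ value r × value r ≤ n
  value-bounds = proj₁ perm

  value-injective : ∀ {i j} → value i ≡ value j → i ≡ j
  value-injective = proj₂ perm _ _

  value-+ : ∀ {r x} → P r ≡ + x → value r ≡ x
  value-+ = cong ∣_∣

  value-− : ∀ {r x} → P r ≡ - (+ x) → value r ≡ x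
  value-− {x = x} eq = trans (cong ∣_∣ eq) (ℤ.∣-i∣≡∣i∣ (+ x))

  entry-injective : ∀ {i j} → P i ≡ P j → i ≡ j
  entry-injective = value-injective ∘ cong ∣_∣

  -- Entries are nonzero, so +x and -x cannot both occur.
  sign-clash : ∀ {i j x} → P i ≡ + x → P j ≡ - (+ x) → ⊥
  sign-clash {i} {j} pi pj with value-injective (trans (value-+ pi) (sym (value-− pj)))
  ... | refl = +≢- (trans (sym pi) pj) (subst (1 ≤_) (value-+ pi) (proj₁ (value-bounds i)))
    where
    +≢- : ∀ {x} → + x ≡ - (+ x) → 1 ≤ x → ⊥
    +≢- {suc _} ()

  range-splits : ∀ {a b c s} → a ≤ b → b ≤ c → value s ≡ b →
                 Splits (InRange a c) (InRange a b) (InRange b c) s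
  range-splits {a} {b} {c} a≤b b≤c s↦b = record
    { cover = ≐-sym (range-∪ a≤b ≤-refl b≤c)
    ; meet  = λ (_ , v≤b) (b≤v , _) → value-injective (trans (≤-antisym v≤b b≤v) (sym s↦b))
    ; atˡ   = subst (InRange a b) (sym s↦b) (a≤b , ≤-refl)
    ; atʳ   = subst (InRange b c) (sym s↦b) (≤-refl , b≤c)
    }

  block-diffˡ : ∀ {a b c} → a < b → b < c → Block P a b → Block P a c → Block P b c
  block-diffˡ a<b b<c (p , q , occ , inj₁ (pa , qb)) (p′ , q′ , occ′ , inj₁ (p′a , q′c))
    with entry-injective (trans p′a (sym pa))
  ... | refl = q , q′ , occupies-splitˡ (range-splits (<⇒≤ a<b) (<⇒≤ b<c) (value-+ qb)) occ occ′ ,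
               inj₁ (qb , q′c)
  block-diffˡ _ _ (_ , _ , _ , inj₁ (pa , _)) (_ , _ , _ , inj₂ (_ , q′a)) = ⊥-elim (sign-clash pa q′a)
  block-diffˡ _ _ (_ , _ , _ , inj₂ (_ , qa)) (_ , _ , _ , inj₁ (p′a , _)) = ⊥-elim (sign-clash p′a qa)
  block-diffˡ a<b b<c (p , q , occ , inj₂ (pb , qa)) (p′ , q′ , occ′ , inj₂ (p′c , q′a))
    with entry-injective (trans q′a (sym qa))
  ... | refl = p′ , p , occupies-splitʳ (range-splits (<⇒≤ a<b) (<⇒≤ b<c) (value-− pb)) occ occ′ ,
               inj₂ (p′c , pb)

  block-diffʳ : ∀ {a b c} → a < b → b < c → Block P a c → Block P b c → Block P a b
  block-diffʳ a<b b<c (p , q , occ , inj₁ (pa , qc)) (p′ , q′ , occ′ , inj₁ (p′b , q′c))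
    with entry-injective (trans q′c (sym qc))
  ... | refl = p , p′ ,
               occupies-splitʳ (splits-swap (range-splits (<⇒≤ a<b) (<⇒≤ b<c) (value-+ p′b))) occ′ occ ,
               inj₁ (pa , p′b)
  block-diffʳ _ _ (_ , _ , _ , inj₁ (_ , qc)) (_ , _ , _ , inj₂ (p′c , _)) = ⊥-elim (sign-clash qc p′c)
  block-diffʳ _ _ (_ , _ , _ , inj₂ (pc , _)) (_ , _ , _ , inj₁ (_ , q′c)) = ⊥-elim (sign-clash q′c pc)
  block-diffʳ a<b b<c (p , q , occ , inj₂ (pc , qa)) (p′ , q′ , occ′ , inj₂ (p′c , q′b))
    with entry-injective (trans p′c (sym pc))
  ... | refl = q′ , q ,
               occupies-splitˡ (splits-swap (range-splits (<⇒≤ a<b) (<⇒≤ b<c) (value-− q′b))) occ′ occ ,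
               inj₂ (q′b , qa)

  block-∪ : ∀ {i j k l} → i < k → k ≤ j → j < l → Block P i j → Block P k l → Block P i l
  block-∪ {i} {j} {k} {l} i<k k≤j j<l (p , q , occ , inj₁ (pi , qj)) (p′ , q′ , occ′ , delim′) =
    p , q′ ,
    occupies-≐ (range-∪ (<⇒≤ i<k) k≤j (<⇒≤ j<l))
               (occupies-∪ {InRange i j} {InRange k l} (<⇒≤ p<p′) p′≤q q≤q′ occ occ′) ,
    inj₁ (pi , q′l)
    where
    p≤q : toℕ p ≤ toℕ q
    p≤q = proj₁ (proj₂ (occ q) (subst (InRange i j) (sym (value-+ qj)) (<⇒≤ (<-≤-trans i<k k≤j) , ≤-refl)))
    q-in-second : Between p′ q′ q
    q-in-second = proj₂ (occ′ q) (subst (InRange k l) (sym (value-+ qj)) (k≤j , <⇒≤ j<l))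
    p′≤q : toℕ p′ ≤ toℕ q
    p′≤q = proj₁ q-in-second
    q≤q′ : toℕ q ≤ toℕ q′
    q≤q′ = proj₂ q-in-second
    p<p′ : toℕ p < toℕ p′
    p<p′ = left-of {InRange k l} occ′ (λ (k≤i , _) → <⇒≱ i<k (subst (k ≤_) (value-+ pi) k≤i))
                   (≤-trans p≤q q≤q′)
    l∉i⋯j : ∀ {r} → P r ≡ - (+ l) → ¬ Between p q r
    l∉i⋯j p′l p′-in-first = <⇒≱ j<l (subst (_≤ j) (value-− p′l) (proj₂ (proj₁ (occ _) p′-in-first)))
    q′l : P q′ ≡ + l
    q′l = [ proj₂ , (λ (p′l , _) → ⊥-elim (l∉i⋯j p′l (<⇒≤ p<p′ , p′≤q))) ]′ delim′
  block-∪ {i} {j} {k} {l} i<k k≤j j<l (p , q , occ , inj₂ (pj , qi)) (p′ , q′ , occ′ , delim′) =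
    p′ , q ,
    occupies-≐ (≐-trans (swap , swap) (range-∪ (<⇒≤ i<k) k≤j (<⇒≤ j<l)))
               (occupies-∪ {InRange k l} {InRange i j} p′≤p p≤q′ (<⇒≤ q′<q) occ′ occ) ,
    inj₂ (p′l , qi)
    where
    p≤q : toℕ p ≤ toℕ q
    p≤q = proj₂ (proj₂ (occ p) (subst (InRange i j) (sym (value-− pj)) (<⇒≤ (<-≤-trans i<k k≤j) , ≤-refl)))
    p-in-second : Between p′ q′ p
    p-in-second = proj₂ (occ′ p) (subst (InRange k l) (sym (value-− pj)) (k≤j , <⇒≤ j<l))
    p′≤p : toℕ p′ ≤ toℕ p
    p′≤p = proj₁ p-in-second
    p≤q′ : toℕ p ≤ toℕ q′
    p≤q′ = proj₂ p-in-second
    q′<q : toℕ q′ < toℕ q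
    q′<q = right-of {InRange k l} occ′ (λ (k≤i , _) → <⇒≱ i<k (subst (k ≤_) (value-− qi) k≤i))
                    (≤-trans p′≤p p≤q)
    l∉i⋯j : ∀ {r} → P r ≡ + l → ¬ Between p q r
    l∉i⋯j q′l q′-in-first = <⇒≱ j<l (subst (_≤ j) (value-+ q′l) (proj₂ (proj₁ (occ _) q′-in-first)))
    p′l : P p′ ≡ - (+ l)
    p′l = [ (λ (_ , q′l) → ⊥-elim (l∉i⋯j q′l (p≤q′ , <⇒≤ q′<q))) , proj₁ ]′ delim′

module ConservedIntervals {n K : ℕ} (𝒫 : Fin K → SignedSeq n)
  (perm : ∀ k → IsSignedPerm n (𝒫 k)) (k₀ : Fin K) where

  private
    module Perm (k : Fin K) where
      open Occupancy (𝒫 k) public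
      open SignedPermutation (𝒫 k) (perm k) public

  conserved-bounds : ∀ {a c} → Conserved 𝒫 a c → 1 ≤ a × a ≤ c × c ≤ n
  conserved-bounds (inj₁ (refl , 1≤a , a≤n)) = 1≤a , ≤-refl , a≤n
  conserved-bounds (inj₂ (a<c , blocks)) with blocks k₀
  ... | p , q , _ , inj₁ (pa , qc) =
    subst (1 ≤_) (value-+ pa) (proj₁ (value-bounds p)) , <⇒≤ a<c ,
    subst (_≤ n) (value-+ qc) (proj₂ (value-bounds q))
    where open Perm k₀
  ... | p , q , _ , inj₂ (pc , qa) =
    subst (1 ≤_) (value-− qa) (proj₁ (value-bounds q)) , <⇒≤ a<c ,
    subst (_≤ n) (value-− pc) (proj₂ (value-bounds p))
    where open Perm k₀

  conserved-reflˡ : ∀ {a c} → Conserved 𝒫 a c → Conserved 𝒫 a a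
  conserved-reflˡ a⋯c = let 1≤a , a≤c , c≤n = conserved-bounds a⋯c in inj₁ (refl , 1≤a , ≤-trans a≤c c≤n)

  conserved-reflʳ : ∀ {a c} → Conserved 𝒫 a c → Conserved 𝒫 c c
  conserved-reflʳ a⋯c = let 1≤a , a≤c , c≤n = conserved-bounds a⋯c in inj₁ (refl , ≤-trans 1≤a a≤c , c≤n)

  conserved-blocks : ∀ {a c} → Conserved 𝒫 a c → a < c → ∀ k → Block (𝒫 k) a c
  conserved-blocks (inj₁ (refl , _)) a<a = ⊥-elim (<-irrefl refl a<a)
  conserved-blocks (inj₂ (_ , blocks)) _ = blocks

  conserved-∪ : ∀ {i j k l} → i < k → k ≤ j → j < l →
                Conserved 𝒫 i j → Conserved 𝒫 k l → Conserved 𝒫 i l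
  conserved-∪ {i} {j} i<k k≤j j<l i⋯j k⋯l = inj₂ (<-trans i<j j<l , λ m →
    Perm.block-∪ m i<k k≤j j<l (conserved-blocks i⋯j i<j m) (conserved-blocks k⋯l (≤-<-trans k≤j j<l) m))
    where
    i<j : i < j
    i<j = <-≤-trans i<k k≤j

  conserved-trans : ∀ {a b c} → Conserved 𝒫 a b → Conserved 𝒫 b c → Conserved 𝒫 a c
  conserved-trans (inj₁ (refl , _)) b⋯c = b⋯c
  conserved-trans a⋯b (inj₁ (refl , _)) = a⋯b
  conserved-trans a⋯b@(inj₂ (a<b , _)) b⋯c@(inj₂ (b<c , _)) = conserved-∪ a<b ≤-refl b<c a⋯b b⋯c

  conserved-diffˡ : ∀ {a b c} → Conserved 𝒫 a b → Conserved 𝒫 a c → b ≤ c → Conserved 𝒫 b c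
  conserved-diffˡ (inj₁ (refl , _)) a⋯c _ = a⋯c
  conserved-diffˡ a⋯b@(inj₂ (a<b , blocks)) a⋯c b≤c with m≤n⇒m<n∨m≡n b≤c
  ... | inj₂ refl = conserved-reflʳ a⋯b
  ... | inj₁ b<c = inj₂ (b<c , λ k →
          Perm.block-diffˡ k a<b b<c (blocks k) (conserved-blocks a⋯c (<-trans a<b b<c) k))

  conserved-diffʳ : ∀ {a b c} → Conserved 𝒫 a c → Conserved 𝒫 b c → a ≤ b → Conserved 𝒫 a b
  conserved-diffʳ a⋯c (inj₁ (refl , _)) _ = a⋯c
  conserved-diffʳ a⋯c b⋯c@(inj₂ (b<c , blocks)) a≤b with m≤n⇒m<n∨m≡n a≤b
  ... | inj₂ refl = conserved-reflˡ b⋯c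
  ... | inj₁ a<b = inj₂ (a<b , λ k →
          Perm.block-diffʳ k a<b b<c (conserved-blocks a⋯c (<-trans a<b b<c) k) (blocks k))

  overlap-conservedˡ : ∀ {i j k l} → i < k → k ≤ j → j < l →
                       Conserved 𝒫 i j → Conserved 𝒫 k l → Conserved 𝒫 i k
  overlap-conservedˡ i<k k≤j j<l i⋯j k⋯l = conserved-diffʳ (conserved-∪ i<k k≤j j<l i⋯j k⋯l) k⋯l (<⇒≤ i<k)

  overlap-conservedʳ : ∀ {i j k l} → i < k → k ≤ j → j < l →
                       Conserved 𝒫 i j → Conserved 𝒫 k l → Conserved 𝒫 j l
  overlap-conservedʳ i<k k≤j j<l i⋯j k⋯l = conserved-diffˡ i⋯j (conserved-∪ i<k k≤j j<l i⋯j k⋯l) (<⇒≤ j<l)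

  conserved? : ∀ a c → Dec (Conserved 𝒫 a c)
  conserved? a c = (a ≟ c ×-dec 1 ≤? a ×-dec a ≤? n) ⊎-dec (a <? c ×-dec all? λ k → block? (𝒫 k))
    where
    inRange? : ∀ a c x → Dec (InRange a c x)
    inRange? a c x = a ≤? x ×-dec x ≤? c
    block? : (P : SignedSeq n) → Dec (Block P a c)
    block? P = any? λ p → any? λ q →
      all? (λ r → (inRange? (toℕ p) (toℕ q) (toℕ r) →-dec inRange? a c ∣ P r ∣) ×-dec
                  (inRange? a c ∣ P r ∣ →-dec inRange? (toℕ p) (toℕ q) (toℕ r)))
      ×-dec ((P p ℤ.≟ + a ×-dec P q ℤ.≟ + c) ⊎-dec (P p ℤ.≟ - (+ c) ×-dec P q ℤ.≟ - (+ a)))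

  IsFrontier : ℕ → ℕ → Pred ℕ 0ℓ
  IsFrontier a c x = Conserved 𝒫 a x × Conserved 𝒫 x c

  isFrontier? : ∀ a c → Decidable (IsFrontier a c)
  isFrontier? a c x = conserved? a x ×-dec conserved? x c

  frontiers : ℕ → ℕ → List ℕ
  frontiers a c = filter (isFrontier? a c) (upTo (suc c))

  ∈-frontiers⁺ : ∀ {a c x} → IsFrontier a c x → x ∈ frontiers a c
  ∈-frontiers⁺ {a} {c} fr@(_ , x⋯c) =
    ∈-filter⁺ (isFrontier? a c) (∈-upTo⁺ (s≤s (proj₁ (proj₂ (conserved-bounds x⋯c))))) fr

  ∈-frontiers⁻ : ∀ a c {x} → x ∈ frontiers a c → IsFrontier a c x
  ∈-frontiers⁻ a c x∈ = proj₂ (∈-filter⁻ (isFrontier? a c) x∈)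

  frontierSet⇒isFrontier : ∀ {a c F x} → Conserved 𝒫 a c → IsFrontierSet 𝒫 a c F → x ∈ F → IsFrontier a c x
  frontierSet⇒isFrontier {a} {c} {x = x} a⋯c (_ , a∈F , c∈F , inRange , conserved) x∈F = from-a , to-c
    where
    x-inRange : InRange a c x
    x-inRange = All.lookup inRange x∈F
    from-a : Conserved 𝒫 a x
    from-a with m≤n⇒m<n∨m≡n (proj₁ x-inRange)
    ... | inj₁ a<x = conserved a x a∈F x∈F a<x
    ... | inj₂ refl = conserved-reflˡ a⋯c
    to-c : Conserved 𝒫 x c
    to-c with m≤n⇒m<n∨m≡n (proj₂ x-inRange)
    ... | inj₁ x<c = conserved x c x∈F c∈F x<c
    ... | inj₂ refl = conserved-reflʳ a⋯c

  frontiers-isFrontierSet : ∀ {a c} → Conserved 𝒫 a c → IsFrontierSet 𝒫 a c (frontiers a c)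
  frontiers-isFrontierSet {a} {c} a⋯c =
    Linkedₚ.filter⁺ (isFrontier? a c) <-trans (Linkedₚ.applyUpTo⁺₂ id (suc c) n<1+n) ,
    ∈-frontiers⁺ (conserved-reflˡ a⋯c , a⋯c) ,
    ∈-frontiers⁺ (a⋯c , conserved-reflʳ a⋯c) ,
    All.tabulate inRange ,
    λ x y x∈ y∈ x<y → conserved-diffˡ (proj₁ (∈-frontiers⁻ a c x∈)) (proj₁ (∈-frontiers⁻ a c y∈)) (<⇒≤ x<y)
    where
    inRange : ∀ {x} → x ∈ frontiers a c → InRange a c x
    inRange x∈ = let a⋯x , x⋯c = ∈-frontiers⁻ a c x∈
                 in proj₁ (proj₂ (conserved-bounds a⋯x)) , proj₁ (proj₂ (conserved-bounds x⋯c))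

  frontiers-isMax : ∀ {a c} → Conserved 𝒫 a c → IsMaxFrontierSet 𝒫 a c (frontiers a c)
  frontiers-isMax a⋯c = frontiers-isFrontierSet a⋯c ,
                        λ _ G-frontiers _ x∈G → ∈-frontiers⁺ (frontierSet⇒isFrontier a⋯c G-frontiers x∈G)

  maxFrontierSet-unique : ∀ {a c G} → Conserved 𝒫 a c → IsMaxFrontierSet 𝒫 a c G → G ≡ frontiers a c
  maxFrontierSet-unique {a} {c} {G} a⋯c (G-frontiers , G-max) =
    sorted-⊆-antisym (proj₁ G-frontiers) (proj₁ F-frontiers) G⊆F (G-max _ F-frontiers G⊆F)
    where
    F-frontiers : IsFrontierSet 𝒫 a c (frontiers a c)
    F-frontiers = frontiers-isFrontierSet a⋯c
    G⊆F : G ⊆ frontiers a c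
    G⊆F x∈G = ∈-frontiers⁺ (frontierSet⇒isFrontier a⋯c G-frontiers x∈G)

  ∈-maxFrontierSet⁺ : ∀ {a c G x} → Conserved 𝒫 a c → IsMaxFrontierSet 𝒫 a c G → IsFrontier a c x → x ∈ G
  ∈-maxFrontierSet⁺ a⋯c G-max fr = subst (_ ∈_) (sym (maxFrontierSet-unique a⋯c G-max)) (∈-frontiers⁺ fr)

  ∈-maxFrontierSet⁻ : ∀ {a c G x} → Conserved 𝒫 a c → IsMaxFrontierSet 𝒫 a c G → x ∈ G → IsFrontier a c x
  ∈-maxFrontierSet⁻ a⋯c G-max = frontierSet⇒isFrontier a⋯c (proj₁ G-max)

  maxFrontierSet-restrict : ∀ {a c e f FI FJ} →
    Conserved 𝒫 a c → Conserved 𝒫 e a → Conserved 𝒫 c f →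
    IsMaxFrontierSet 𝒫 a c FI → IsMaxFrontierSet 𝒫 e f FJ →
    ∀ x → ((x ∈ FI) → (x ∈ FJ) × InRange a c x) × ((x ∈ FJ) × InRange a c x → x ∈ FI)
  maxFrontierSet-restrict {a} {c} {e} {f} {FI} {FJ} a⋯c e⋯a c⋯f FI-max FJ-max x = restrict , extend
    where
    e⋯f : Conserved 𝒫 e f
    e⋯f = conserved-trans e⋯a (conserved-trans a⋯c c⋯f)
    restrict : x ∈ FI → x ∈ FJ × InRange a c x
    restrict x∈FI =
      let a⋯x , x⋯c = ∈-maxFrontierSet⁻ a⋯c FI-max x∈FI
      in ∈-maxFrontierSet⁺ e⋯f FJ-max (conserved-trans e⋯a a⋯x , conserved-trans x⋯c c⋯f) ,
         proj₁ (proj₂ (conserved-bounds a⋯x)) , proj₁ (proj₂ (conserved-bounds x⋯c))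
    extend : x ∈ FJ × InRange a c x → x ∈ FI
    extend (x∈FJ , a≤x , x≤c) =
      let e⋯x , x⋯f = ∈-maxFrontierSet⁻ e⋯f FJ-max x∈FJ
      in ∈-maxFrontierSet⁺ a⋯c FI-max (conserved-diffˡ e⋯a e⋯x a≤x , conserved-diffʳ x⋯f c⋯f x≤c)

  leftmost : ∀ {a} → Conserved 𝒫 a a → ∃ λ e → Conserved 𝒫 e a × (∀ {y} → y < e → ¬ Conserved 𝒫 y a)
  leftmost {a} a⋯a =
    let e , e⋯a , _ , e-least = least-witness (λ x → conserved? x a) a⋯a in e , e⋯a , e-least

  rightmost : ∀ {c} → Conserved 𝒫 c c → ∃ λ f → Conserved 𝒫 c f × (∀ {y} → f < y → ¬ Conserved 𝒫 c y)
  rightmost {c} = greatest-witness (conserved? c) (λ c⋯y → proj₂ (proj₂ (conserved-bounds c⋯y)))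

  module Span {a c e f} (a⋯c : Conserved 𝒫 a c) (a<c : a < c)
    (e⋯a : Conserved 𝒫 e a) (e-least : ∀ {y} → y < e → ¬ Conserved 𝒫 y a)
    (c⋯f : Conserved 𝒫 c f) (f-greatest : ∀ {y} → f < y → ¬ Conserved 𝒫 c y) where

    e≤a : e ≤ a
    e≤a = proj₁ (proj₂ (conserved-bounds e⋯a))

    c≤f : c ≤ f
    c≤f = proj₁ (proj₂ (conserved-bounds c⋯f))

    e⋯f : Conserved 𝒫 e f
    e⋯f = conserved-trans e⋯a (conserved-trans a⋯c c⋯f)

    span-strong : Strong 𝒫 e f
    span-strong = e⋯f , ≤-<-trans e≤a (<-≤-trans a<c c≤f) , no-overlap
      where
      no-overlap : ∀ k l → Conserved 𝒫 k l → ¬ Overlap 𝒫 e f k l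
      no-overlap k l k⋯l (inj₁ (e<k , k≤f , f<l)) =
        f-greatest f<l (conserved-trans c⋯f (overlap-conservedʳ e<k k≤f f<l e⋯f k⋯l))
      no-overlap k l k⋯l (inj₂ (k<e , e≤l , l<f)) =
        e-least k<e (conserved-trans (overlap-conservedˡ k<e e≤l l<f k⋯l e⋯f) e⋯a)

    span-unique : ∀ {e′ f′ G} → Strong 𝒫 e′ f′ → IsMaxFrontierSet 𝒫 e′ f′ G → a ∈ G → c ∈ G →
                  e′ ≡ e × f′ ≡ f
    span-unique {e′} {f′} (e′⋯f′ , e′<f′ , no-overlap) G-max a∈G c∈G = left , right
      where
      e′⋯a : Conserved 𝒫 e′ a
      e′⋯a = proj₁ (∈-maxFrontierSet⁻ e′⋯f′ G-max a∈G)
      c⋯f′ : Conserved 𝒫 c f′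
      c⋯f′ = proj₂ (∈-maxFrontierSet⁻ e′⋯f′ G-max c∈G)
      left : e′ ≡ e
      left with <-cmp e′ e
      ... | tri< e′<e _ _ = ⊥-elim (e-least e′<e e′⋯a)
      ... | tri≈ _ e′≡e _ = e′≡e
      ... | tri> _ _ e<e′ = ⊥-elim (no-overlap e e′ (conserved-diffʳ e⋯a e′⋯a (<⇒≤ e<e′))
                                                   (inj₂ (e<e′ , ≤-refl , e′<f′)))
      right : f′ ≡ f
      right with <-cmp f′ f
      ... | tri< f′<f _ _ = ⊥-elim (no-overlap f′ f (conserved-diffˡ c⋯f′ c⋯f (<⇒≤ f′<f))
                                                   (inj₁ (e′<f′ , ≤-refl , f′<f)))
      ... | tri≈ _ f′≡f _ = f′≡f
      ... | tri> _ _ f<f′ = ⊥-elim (f-greatest f<f′ c⋯f′)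

    span-container : IsContainer 𝒫 a c e f
    span-container = span-strong , e≤a , c≤f , λ g h (_ , _ , no-overlap) g≤a c≤h →
      ≮⇒≥ (λ e<g → no-overlap e a e⋯a (inj₂ (e<g , g≤a , <-≤-trans a<c c≤h))) ,
      ≮⇒≥ (λ h<f → no-overlap c f c⋯f (inj₁ (≤-<-trans g≤a a<c , c≤h , h<f)))

    strong⇒tight : Strong 𝒫 a c → e ≡ a × f ≡ c
    strong⇒tight (_ , _ , no-overlap) =
      ≤-antisym e≤a (≮⇒≥ λ e<a → no-overlap e a e⋯a (inj₂ (e<a , ≤-refl , a<c))) ,
      ≤-antisym (≮⇒≥ λ c<f → no-overlap c f c⋯f (inj₁ (a<c , ≤-refl , c<f))) c≤f

    tight⇒strong : e ≡ a → f ≡ c → Strong 𝒫 a c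
    tight⇒strong e≡a f≡c = subst₂ (Strong 𝒫) e≡a f≡c span-strong

theorem5 : (n K : ℕ) → 2 ≤ n → 1 ≤ K →
  (𝒫 : Fin K → SignedSeq n) →
  (∀ k → IsSignedPerm n (𝒫 k)) →
  (∀ k → FramedPerm n (𝒫 k)) →
  (∀ k → toℕ k ≡ 0 → IsIdentity n (𝒫 k)) →
  ((a c : ℕ) → Conserved 𝒫 a c →
     Σ (List ℕ) λ F → IsMaxFrontierSet 𝒫 a c F ×
       (∀ G → IsMaxFrontierSet 𝒫 a c G → G ≡ F)) ×
  ((a c : ℕ) → Conserved 𝒫 a c → a < c →
     Strong 𝒫 a c ⊎
     (Weak 𝒫 a c ×
      Σ ℕ λ e → Σ ℕ λ f →
        (Strong 𝒫 e f ×
         Σ (List ℕ) λ FJ → IsMaxFrontierSet 𝒫 e f FJ ×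
           Σ ℕ λ fi → Σ ℕ λ fj →
             (fi ∈ FJ) × (fj ∈ FJ) × (fi < fj) × (a ≡ fi) × (c ≡ fj)) ×
        (∀ e′ f′ → Strong 𝒫 e′ f′ →
           (Σ (List ℕ) λ FJ′ → IsMaxFrontierSet 𝒫 e′ f′ FJ′ ×
             Σ ℕ λ fi → Σ ℕ λ fj →
               (fi ∈ FJ′) × (fj ∈ FJ′) × (fi < fj) × (a ≡ fi) × (c ≡ fj)) →
           (e′ ≡ e) × (f′ ≡ f)) ×
        (∀ FI FJ → IsMaxFrontierSet 𝒫 a c FI → IsMaxFrontierSet 𝒫 e f FJ →
           ∀ x → ((x ∈ FI) → (x ∈ FJ) × InRange a c x) ×
                 ((x ∈ FJ) × InRange a c x → x ∈ FI)) ×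
        IsContainer 𝒫 a c e f))
theorem5 _ _ _ K≥1 𝒫 perm _ _ =
  (λ a c a⋯c → frontiers a c , frontiers-isMax a⋯c , λ _ → maxFrontierSet-unique a⋯c) ,
  λ a c a⋯c a<c → case leftmost (conserved-reflˡ a⋯c) , rightmost (conserved-reflʳ a⋯c) of λ
    { ((e , e⋯a , e-least) , (f , c⋯f , f-greatest)) →
      let open Span a⋯c a<c e⋯a e-least c⋯f f-greatest
          a∈FJ = ∈-frontiers⁺ (e⋯a , conserved-trans a⋯c c⋯f)
          c∈FJ = ∈-frontiers⁺ (conserved-trans e⋯a a⋯c , c⋯f)
      in [ (λ (e≡a , f≡c) → inj₁ (tight⇒strong e≡a f≡c)) ,
           (λ wide → inj₂ ((a⋯c , wide ∘ strong⇒tight) , e , f ,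
              (span-strong , frontiers e f , frontiers-isMax e⋯f , a , c , a∈FJ , c∈FJ , a<c , refl , refl) ,
              (λ { _ _ J′-strong (_ , FJ′-max , _ , _ , a∈FJ′ , c∈FJ′ , _ , refl , refl) →
                     span-unique J′-strong FJ′-max a∈FJ′ c∈FJ′ }) ,
              (λ _ _ → maxFrontierSet-restrict a⋯c e⋯a c⋯f) , span-container)) ]′
         (toSum (e ≟ a ×-dec f ≟ c)) }
  where open ConservedIntervals 𝒫 perm (fromℕ< K≥1)
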